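{- Let $p$ be an odd prime, $K$ a $p$-adic field with absolute ramification index $e$, and $L/K$ a typical degree $p$ extension with totally ramified normal closure $\widetilde{L}$, with $r,t,c,\ell,a$ as in the context, and let $\nu_{p-1}=\lfloor\frac{a+(p-1)\ell}{p}\rfloor$. Then the number $\mathfrak{c}=pe-\frac{p-1}{r}t$ (the precision of Elder's scaffold on $L/K$) satisfies $\mathfrak{c}=p\left(e+\frac{p-1}{r}(r-1)c-\nu_{p-1}\right)+a$; in particular the remainder of $\mathfrak{c}$ modulo $p$ is $a$.
   Context: $L/K$ is typical if it is not generated over $K$ by a $p$-th root of a uniformizer of $K$. $r=[\widetilde{L}:L]$, $t$ is the ramification jump of $\widetilde{L}/K$ (the integer with $G_t\cong C_p$, $G_{t+1}=1$ for the lower ramification groups of $\mathrm{Gal}(\widetilde{L}/K)$), $c$ is the remainder of $t$ mod $r$, $\ell=\frac{pc(r-1)+t}{r}$ (an integer) and $a$ the remainder of $\ell$ mod $p$. -}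

module Defs where

open import Data.Nat using (ℕ; _+_; _*_; _∸_; NonZero)
open import Data.Nat.DivMod using (_/_; _%_)
open import Data.Integer using (ℤ; +_) renaming (_-_ to _-ℤ_; _+_ to _+ℤ_; _*_ to _*ℤ_)

-- Numerical invariants attached to L/K (context).  r = [L~ : L] (nonzero),
-- t = ramification jump of L~/K, e = absolute ramification index of K.

c-of : (r t : ℕ) → .{{NonZero r}} → ℕ
c-of r t = t % r

ℓ-num : (p r t : ℕ) → .{{NonZero r}} → ℕ
ℓ-num p r t = p * c-of r t * (r ∸ 1) + t

-- ℓ = (p c (r-1) + t) / r   (an integer by hypothesis)
ℓ-of : (p r t : ℕ) → .{{NonZero r}} → ℕ
ℓ-of p r t = ℓ-num p r t / r

a-of : (p r t : ℕ) → .{{NonZero p}} → .{{NonZero r}} → ℕ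
a-of p r t = ℓ-of p r t % p

ν-of : (p r t : ℕ) → .{{NonZero p}} → .{{NonZero r}} → ℕ
ν-of p r t = (a-of p r t + (p ∸ 1) * ℓ-of p r t) / p

-- the precision 𝔠 = p e - ((p-1)/r) t   (r ∣ p-1, so (p-1)/r is an integer)
precision : (p e r t : ℕ) → .{{NonZero r}} → ℤ
precision p e r t = + (p * e) -ℤ (+ (((p ∸ 1) / r) * t))

precision-rhs : (p e r t : ℕ) → .{{NonZero p}} → .{{NonZero r}} → ℤ
precision-rhs p e r t =
  (+ p) *ℤ ((+ e) +ℤ (+ (((p ∸ 1) / r) * (r ∸ 1) * c-of r t)) -ℤ (+ ν-of p r t))
  +ℤ (+ a-of p r t)

-- The ramification data enter only through two divisibilities: (p-1) = m r with m = (p-1)/r,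
-- and r ℓ = p c (r-1) + t.  Hence (p-1) ℓ = m (p c (r-1) + t) = p k + m t with k = m (r-1) c.
-- Writing ℓ = a + q p, the floor in ν_{p-1} is exact: a + (p-1) ℓ = p (a + (p-1) q), so
-- p ν_{p-1} = a + m t + p k, which rearranges to p e - m t = p (e + k - ν_{p-1}) + a.
-- Since 0 ≤ a < p, the remainder of 𝔠 modulo p is a.
module Submission where

open import Defs
open import Data.Nat using (ℕ; _≤_; _∸_; NonZero)
open import Data.Nat.Divisibility using (_∣_)
open import Data.Nat.Primality using (Prime)
open import Data.Product using (_×_)
open import Relation.Binary.PropositionalEquality using (_≡_)
open import Relation.Nullary using (¬_)
open import Data.Integer.DivMod using (_%ℕ_)

open import Data.Product using (_,_)
open import Data.Nat using (suc; _+_; _*_; _<_; _⊔_)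
import Data.Nat.Properties as ℕ
open import Data.Nat.DivMod using (_/_; _%_; m≡m%n+[m/n]*n; m*[n/m]≡n; m/n*n≡m; m%n<n)
open import Data.Nat.Divisibility using (divides)
import Data.Nat.Tactic.RingSolver as ℕ-Solver
open import Data.Integer using (ℤ; +_; ∣_∣; 0ℤ; _⊖_)
  renaming (_+_ to _+ℤ_; _-_ to _-ℤ_; _*_ to _*ℤ_)
import Data.Integer.Properties as ℤ
open import Data.Integer.DivMod using (_/ℕ_; a≡a%ℕn+[a/ℕn]*n; n%ℕd<d)
import Data.Integer.Tactic.RingSolver as ℤ-Solver
open import Relation.Binary.PropositionalEquality using (sym; trans; cong; module ≡-Reasoning)

m-n≡i*d⇒m≡n : ∀ {m n d} (i : ℤ) → m < d → n < d → + m -ℤ + n ≡ i *ℤ + d → m ≡ n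
m-n≡i*d⇒m≡n {m} {n} {d} i m<d n<d m-n≡i*d =
  ℤ.+-injective (ℤ.i-j≡0⇒i≡j (+ m) (+ n) (trans m-n≡i*d (cong (_*ℤ + d) i≡0)))
  where
  ∣i∣*d<1*d : ∣ i ∣ * d < 1 * d
  ∣i∣*d<1*d = begin-strict
    ∣ i ∣ * d      ≡⟨ ℤ.abs-* i (+ d) ⟨
    ∣ i *ℤ + d ∣   ≡⟨ cong ∣_∣ (trans (sym m-n≡i*d) (ℤ.m-n≡m⊖n m n)) ⟩
    ∣ m ⊖ n ∣      ≤⟨ ℤ.∣m⊝n∣≤m⊔n m n ⟩
    m ⊔ n          <⟨ ℕ.⊔-pres-<m m<d n<d ⟩
    d              ≡⟨ ℕ.*-identityˡ d ⟨
    1 * d          ∎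
    where open ℕ.≤-Reasoning
  i≡0 : i ≡ 0ℤ
  i≡0 = ℤ.∣i∣≡0⇒i≡0 (ℕ.n<1⇒n≡0 (ℕ.*-cancelʳ-< d ∣ i ∣ 1 ∣i∣*d<1*d))

[d*k+a]%ℕd≡a : ∀ d .{{_ : NonZero d}} (k : ℤ) {a} → a < d → (+ d *ℤ k +ℤ + a) %ℕ d ≡ a
[d*k+a]%ℕd≡a d k {a} a<d = sym (m-n≡i*d⇒m≡n (q -ℤ k) a<d (n%ℕd<d n d) a-r≡[q-k]*d)
  where
  n = + d *ℤ k +ℤ + a
  r = n %ℕ d
  q = n /ℕ d
  u = + r +ℤ q *ℤ + d
  a-r≡[q-k]*d : + a -ℤ + r ≡ (q -ℤ k) *ℤ + d
  a-r≡[q-k]*d = begin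
    + a -ℤ + r                    ≡⟨ regroup (+ a) (+ r) q k (+ d) ⟩
    (q -ℤ k) *ℤ + d +ℤ (n -ℤ u)   ≡⟨ cong (λ x → (q -ℤ k) *ℤ + d +ℤ (x -ℤ u)) (a≡a%ℕn+[a/ℕn]*n n d) ⟩
    (q -ℤ k) *ℤ + d +ℤ (u -ℤ u)   ≡⟨ cong (λ x → (q -ℤ k) *ℤ + d +ℤ x) (ℤ.+-inverseʳ u) ⟩
    (q -ℤ k) *ℤ + d +ℤ 0ℤ         ≡⟨ ℤ.+-identityʳ _ ⟩
    (q -ℤ k) *ℤ + d               ∎
    where
    open ≡-Reasoning
    regroup : ∀ A R Q K D → A -ℤ R ≡ (Q -ℤ K) *ℤ D +ℤ ((D *ℤ K +ℤ A) -ℤ (R +ℤ Q *ℤ D))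
    regroup = ℤ-Solver.solve-∀

n∣m%n+[n∸1]*m : ∀ m n .{{_ : NonZero n}} → n ∣ m % n + (n ∸ 1) * m
n∣m%n+[n∸1]*m m n@(suc n-1) = divides (m % n + n-1 * (m / n)) (begin
  m % n + n-1 * m                     ≡⟨ cong (λ x → m % n + n-1 * x) (m≡m%n+[m/n]*n m n) ⟩
  m % n + n-1 * (m % n + m / n * n)   ≡⟨ regroup (m % n) (m / n) n-1 ⟩
  (m % n + n-1 * (m / n)) * n         ∎)
  where
  open ≡-Reasoning
  regroup : ∀ x q k → x + k * (x + q * suc k) ≡ (x + k * q) * suc k
  regroup = ℕ-Solver.solve-∀

p*ν≡a+[p∸1]*ℓ : ∀ p r t .{{_ : NonZero p}} .{{_ : NonZero r}} →
                p * ν-of p r t ≡ a-of p r t + (p ∸ 1) * ℓ-of p r t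
p*ν≡a+[p∸1]*ℓ p r t = m*[n/m]≡n (n∣m%n+[n∸1]*m (ℓ-of p r t) p)

[p∸1]*ℓ≡p*k+m*t : ∀ p r t .{{_ : NonZero r}} → r ∣ p ∸ 1 → r ∣ ℓ-num p r t →
                  (p ∸ 1) * ℓ-of p r t ≡ p * ((p ∸ 1) / r * (r ∸ 1) * c-of r t) + (p ∸ 1) / r * t
[p∸1]*ℓ≡p*k+m*t p r t r∣p-1 r∣ℓ-num = begin
  (p ∸ 1) * ℓ                     ≡⟨ cong (_* ℓ) (m/n*n≡m r∣p-1) ⟨
  m * r * ℓ                       ≡⟨ ℕ.*-assoc m r ℓ ⟩
  m * (r * ℓ)                     ≡⟨ cong (m *_) (m*[n/m]≡n r∣ℓ-num) ⟩
  m * (p * c * (r ∸ 1) + t)       ≡⟨ regroup m p c (r ∸ 1) t ⟩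
  p * (m * (r ∸ 1) * c) + m * t   ∎
  where
  open ≡-Reasoning
  m = (p ∸ 1) / r
  c = c-of r t
  ℓ = ℓ-of p r t
  regroup : ∀ m p c s t → m * (p * c * s + t) ≡ p * (m * s * c) + m * t
  regroup = ℕ-Solver.solve-∀

p*v≡a+[p*k+s]⇒p*e-s≡p*[e+k-v]+a : ∀ p e k v a s → p * v ≡ a + (p * k + s) →
                                   + (p * e) -ℤ + s ≡ + p *ℤ (+ e +ℤ + k -ℤ + v) +ℤ + a
p*v≡a+[p*k+s]⇒p*e-s≡p*[e+k-v]+a p e k v a s p*v≡a+[p*k+s] = begin
  + (p * e) -ℤ + s              ≡⟨ cong (_-ℤ + s) (ℤ.pos-* p e) ⟩
  + p *ℤ + e -ℤ + s             ≡⟨ regroup (+ p) (+ e) (+ k) (+ v) (+ a) (+ s) ⟩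
  R +ℤ (+ p *ℤ + v -ℤ N)        ≡⟨ cong (λ x → R +ℤ (x -ℤ N)) +p*+v≡N ⟩
  R +ℤ (N -ℤ N)                 ≡⟨ cong (R +ℤ_) (ℤ.+-inverseʳ N) ⟩
  R +ℤ 0ℤ                       ≡⟨ ℤ.+-identityʳ R ⟩
  R                             ∎
  where
  open ≡-Reasoning
  R = + p *ℤ (+ e +ℤ + k -ℤ + v) +ℤ + a
  N = + a +ℤ (+ p *ℤ + k +ℤ + s)
  +p*+v≡N : + p *ℤ + v ≡ N
  +p*+v≡N = begin
    + p *ℤ + v                    ≡⟨ ℤ.pos-* p v ⟨
    + (p * v)                     ≡⟨ cong +_ p*v≡a+[p*k+s] ⟩
    + (a + (p * k + s))           ≡⟨ ℤ.pos-+ a (p * k + s) ⟩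
    + a +ℤ + (p * k + s)          ≡⟨ cong (+ a +ℤ_) (ℤ.pos-+ (p * k) s) ⟩
    + a +ℤ (+ (p * k) +ℤ + s)     ≡⟨ cong (λ x → + a +ℤ (x +ℤ + s)) (ℤ.pos-* p k) ⟩
    N                             ∎
  regroup : ∀ P E K V A S → P *ℤ E -ℤ S ≡
            P *ℤ (E +ℤ K -ℤ V) +ℤ A +ℤ (P *ℤ V -ℤ (A +ℤ (P *ℤ K +ℤ S)))
  regroup = ℤ-Solver.solve-∀

proposition6p5 : (p e r t : ℕ) → .{{_ : NonZero p}} → .{{_ : NonZero r}} →
    Prime p → ¬ (2 ∣ p) → 1 ≤ e → r ∣ (p ∸ 1) → r ∣ ℓ-num p r t →
    (precision p e r t ≡ precision-rhs p e r t)
    × (precision p e r t %ℕ p ≡ a-of p r t)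
proposition6p5 p e r t _ _ _ r∣p-1 r∣ℓ-num = 𝔠≡rhs , 𝔠%p≡a
  where
  m = (p ∸ 1) / r
  k = m * (r ∸ 1) * c-of r t
  a = a-of p r t
  ν = ν-of p r t
  p*ν≡a+[p*k+m*t] : p * ν ≡ a + (p * k + m * t)
  p*ν≡a+[p*k+m*t] = trans (p*ν≡a+[p∸1]*ℓ p r t) (cong (λ x → a + x) ([p∸1]*ℓ≡p*k+m*t p r t r∣p-1 r∣ℓ-num))
  𝔠≡rhs : precision p e r t ≡ precision-rhs p e r t
  𝔠≡rhs = p*v≡a+[p*k+s]⇒p*e-s≡p*[e+k-v]+a p e k ν a (m * t) p*ν≡a+[p*k+m*t]
  𝔠%p≡a : precision p e r t %ℕ p ≡ a
  𝔠%p≡a = trans (cong (_%ℕ p) 𝔠≡rhs) ([d*k+a]%ℕd≡a p (+ e +ℤ + k -ℤ + ν) (m%n<n (ℓ-of p r t) p))
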